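{- Let $G$ be a finite abelian group and let $\Omega,\Omega'\subset\mathcal B(G)$. Then: (1) $d_{\Omega}(G)<\infty$ if and only if for every $g\in G$ there is a positive integer $k=k(g)$ with $g^{k\,\mathrm{ord}(g)}\in\Omega$. (2) If $\Omega\subset\Omega'$, then $d_{\Omega'}(G)\le d_{\Omega}(G)$. (3) If $S_1$ is a proper subsequence of a sequence $S$ and both $S$ and $S_1$ belong to $\Omega$, then $d_{\Omega\setminus\{S\}}(G)=d_{\Omega}(G)$. (4) For every integer $t\ge \mathsf D(G)$ there is $\Omega\subset\mathcal B(G)$ with $d_{\Omega}(G)=t$.
   Context: $G$ is a finite abelian group written additively; $\mathrm{ord}(g)$ is the order of $g$. A sequence over $G$ is a finite unordered list of elements of $G$ with repetition allowed (an element of the free abelian monoid on $G$), written $S=g_1\cdot\ldots\cdot g_l$; $|S|=l$ is its length, $\sigma(S)=g_1+\dots+g_l$ its sum, $\mathsf v_g(S)$ the multiplicity of $g$ in $S$, and $g^k$ denotes the sequence consisting of $g$ repeated $k$ times. A subsequence of $S$ is a sequence $T$ with $\mathsf v_g(T)\le \mathsf v_g(S)$ for all $g$. $\mathcal B(G)$ is the set of all nonempty sequences $S$ over $G$ with $\sigma(S)=0$. For $\Omega\subset\mathcal B(G)$, $d_{\Omega}(G)$ is the smallest integer $t$ such that every sequence $S$ over $G$ with $|S|\ge t$ has a subsequence belonging to $\Omega$, and $d_\Omega(G)=\infty$ if no such $t$ exists. $\mathsf D(G)$ (Davenport constant) is the smallest $t$ such that every sequence over $G$ of length at least $t$ has a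 nonempty zero-sum subsequence. -}

module Defs where

open import Level using (0ℓ)
open import Data.Nat using (ℕ; zero; suc; _≤_; _<_; _*_)
open import Data.Fin using (Fin)
open import Data.List using (List; []; _∷_; _++_; foldr; length; replicate)
open import Data.List.Relation.Binary.Permutation.Propositional using (_↭_)
open import Data.Product using (Σ; ∃; _×_; _,_)
open import Relation.Binary.PropositionalEquality using (_≡_; _≢_)
open import Relation.Nullary using (¬_)
open import Algebra.Structures using (IsAbelianGroup)
open import Function.Bundles using (_↔_)

record FinAbGroup : Set₁ where
  field
    Carrier : Set
    _+_     : Carrier → Carrier → Carrier
    0#      : Carrier
    -_      : Carrier → Carrier
    isAbelianGroup : IsAbelianGroup _≡_ _+_ 0# -_
    size    : ℕ
    enum    : Carrier ↔ Fin size

module _ (G : FinAbGroup) where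
  open FinAbGroup G

  -- Sequences over G: lists, considered up to permutation (_↭_).
  Seq : Set
  Seq = List Carrier

  mul : ℕ → Carrier → Carrier
  mul zero    g = 0#
  mul (suc n) g = g + mul n g

  IsOrder : Carrier → ℕ → Set
  IsOrder g n = 0 < n × mul n g ≡ 0# × (∀ m → 0 < m → mul m g ≡ 0# → n ≤ m)

  σ : Seq → Carrier
  σ = foldr _+_ 0#

  _⊑_ : Seq → Seq → Set
  T ⊑ S = Σ Seq λ U → (T ++ U) ↭ S

  _⊏_ : Seq → Seq → Set
  T ⊏ S = Σ Seq λ U → U ≢ [] × (T ++ U) ↭ S

  InB : Seq → Set
  InB S = S ≢ [] × σ S ≡ 0#

  -- Ω ⊂ B(G); Ω is a set of sequences (unordered), hence closed under permutation
  SubsetB : (Seq → Set) → Set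
  SubsetB Ω = (∀ S → Ω S → InB S) × (∀ S T → S ↭ T → Ω S → Ω T)

  remove : (Seq → Set) → Seq → Seq → Set
  remove Ω S T = Ω T × ¬ (T ↭ S)

  Works : (Seq → Set) → ℕ → Set
  Works Ω t = ∀ S → t ≤ length S → Σ Seq λ T → T ⊑ S × Ω T

  DFinite : (Seq → Set) → Set
  DFinite Ω = ∃ λ t → Works Ω t

  IsD : (Seq → Set) → ℕ → Set
  IsD Ω t = Works Ω t × (∀ t' → Works Ω t' → t ≤ t')

  IsDavenport : ℕ → Set
  IsDavenport = IsD InB

module Submission where

-- Part (1) applies the pigeonhole principle with c(g) = k(g)·ord(g) in one
-- direction and tests the sequence g^{t·ord(g)} in the other.  For part (4) we take
-- Ω = {zero-sum T : |T| > t − D(G)}: by induction every sequence of length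
-- D(G) + j has a zero-sum subsequence longer than j, and padding a sequence
-- with t − D(G) zeros shows that no smaller threshold works.

open import Defs
open import Level using (0ℓ)
open import Data.Nat using (ℕ; zero; suc; _+_; _*_; _∸_; _≤_; _<_; _≤?_; z≤n; s≤s; NonZero; >-nonZero)
open import Data.Nat.Properties
  using (n<1+n; n≤1+n; ≤-pred; 1+n≰n; ≤-trans; <-≤-trans; <-irrefl; <⇒≱; ≮⇒≥; ≰⇒>; _<?_; 0≢1+n
        ; +-comm; +-suc; +-identityʳ; m≤m+n; m<m+n; m≤m*n; m+[n∸m]≡n; m≤n⇒∃[o]m+o≡n
        ; +-monoˡ-≤; +-monoʳ-≤; +-monoˡ-<; +-cancelˡ-≤; +-cancelˡ-<; module ≤-Reasoning)
open import Data.Nat.DivMod using (_/_; _%_; m≡m%n+[m/n]*n; m%n<n)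
open import Data.Nat.Divisibility using (_∣_; divides; m%n≡0⇒n∣m)
open import Data.Fin using (toℕ)
open import Data.Fin.Properties using (pigeonhole; inj⇒≟)
open import Data.List using (List; []; _∷_; _++_; length; replicate; filter; map; allFin)
open import Data.Nat.ListAction using (sum)
open import Data.List.Properties using (length-++; length-replicate; ++-assoc; ++-identityʳ; filter-++; filter-all; filter-none; filter-accept; filter-reject)
open import Data.List.Membership.Propositional using (_∈_)
open import Data.List.Membership.Propositional.Properties using (∈-map⁺; ∈-allFin; ∈-∃++)
open import Data.List.Relation.Unary.All using (All; []; _∷_; universal)
open import Data.List.Relation.Unary.All.Properties using (++⁻ˡ; ¬Any⇒All¬; replicate⁺)
open import Data.List.Relation.Unary.Any using (here; there; any?)
open import Data.List.Relation.Binary.Permutation.Propositional using (_↭_; ↭-refl; ↭-reflexive; ↭-sym; ↭-trans; prep; ↭⇒↭ₛ)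
open import Data.List.Relation.Binary.Permutation.Propositional.Properties using (++⁺ˡ; ++⁺ʳ; ++-comm; shift; drop-∷; ↭-length; ↭-empty-inv; All-resp-↭; ∈-resp-↭; filter-↭)
open import Data.List.Relation.Binary.Permutation.Setoid.Properties using (foldr-commMonoid)
open import Data.Product using (Σ; ∃; _×_; _,_; proj₁; proj₂; map₂)
open import Data.Empty using (⊥-elim)
open import Relation.Binary.PropositionalEquality using (_≡_; _≢_; refl; sym; trans; cong; cong₂; subst; setoid; module ≡-Reasoning)
open import Relation.Binary.Definitions using (DecidableEquality)
open import Relation.Nullary using (¬_; Dec; yes; no; ¬?)
import Relation.Unary as U
open import Algebra.Bundles using (Group)
open import Algebra.Structures using (IsAbelianGroup)
import Algebra.Properties.Group as GroupProperties
open import Function.Bundles using (Inverse; Injection; Equivalence; _⇔_; mk⇔)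
open import Function.Properties.Inverse using (↔⇒↣)

least-witness : {P : ℕ → Set} → U.Decidable P → ∀ d → P d
  → Σ ℕ λ n → P n × (∀ m → P m → n ≤ m)
least-witness P? zero p = 0 , p , λ _ _ → z≤n
least-witness P? (suc d) p with P? 0
... | yes p₀ = 0 , p₀ , λ _ _ → z≤n
... | no ¬p₀ with least-witness (λ m → P? (suc m)) d p
...   | n , pₙ , least = suc n , pₙ , λ
  { zero    p₀ → ⊥-elim (¬p₀ p₀)
  ; (suc m) pₘ → s≤s (least m pₘ) }

length-filter-split : ∀ {A : Set} {P : A → Set} (P? : U.Decidable P) (xs : List A)
  → length xs ≡ length (filter P? xs) + length (filter (λ x → ¬? (P? x)) xs)
length-filter-split P? []       = refl
length-filter-split P? (x ∷ xs) with P? x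
... | yes _ = cong suc (length-filter-split P? xs)
... | no  _ = trans (cong suc (length-filter-split P? xs)) (sym (+-suc _ _))

module Theory (G : FinAbGroup) where
  open FinAbGroup G renaming (_+_ to _⊕_)
  open IsAbelianGroup isAbelianGroup using (assoc; identityˡ; identityʳ; isCommutativeMonoid)

  group : Group 0ℓ 0ℓ
  group = record { isGroup = IsAbelianGroup.isGroup isAbelianGroup }
  open GroupProperties group using (identityˡ-unique)

  _≟_ : DecidableEquality Carrier
  _≟_ = inj⇒≟ (↔⇒↣ enum)

  elements : List Carrier
  elements = map (Inverse.from enum) (allFin size)

  ∈-elements : ∀ x → x ∈ elements
  ∈-elements x = subst (_∈ elements) (Inverse.strictlyInverseʳ enum x)
    (∈-map⁺ (Inverse.from enum) (∈-allFin (Inverse.to enum x)))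

  mul-+ : ∀ a b g → mul G (a + b) g ≡ mul G a g ⊕ mul G b g
  mul-+ zero    b g = sym (identityˡ _)
  mul-+ (suc a) b g = trans (cong (g ⊕_) (mul-+ a b g)) (sym (assoc g _ _))

  mul-multiple : ∀ k n g → mul G n g ≡ 0# → mul G (k * n) g ≡ 0#
  mul-multiple zero    n g _  = refl
  mul-multiple (suc k) n g ng = begin
    mul G (n + k * n) g              ≡⟨ mul-+ n (k * n) g ⟩
    mul G n g ⊕ mul G (k * n) g      ≡⟨ cong₂ _⊕_ ng (mul-multiple k n g ng) ⟩
    0# ⊕ 0#                          ≡⟨ identityˡ 0# ⟩
    0#                               ∎
    where open ≡-Reasoning

  σ-++ : ∀ S T → σ G (S ++ T) ≡ σ G S ⊕ σ G T
  σ-++ []      T = sym (identityˡ _)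
  σ-++ (x ∷ S) T = trans (cong (x ⊕_) (σ-++ S T)) (sym (assoc x _ _))

  σ-↭ : ∀ {S T} → S ↭ T → σ G S ≡ σ G T
  σ-↭ p = foldr-commMonoid (setoid Carrier) isCommutativeMonoid (↭⇒↭ₛ p)

  σ-replicate : ∀ m g → σ G (replicate m g) ≡ mul G m g
  σ-replicate zero    g = refl
  σ-replicate (suc m) g = cong (g ⊕_) (σ-replicate m g)

  -- Some positive multiple of g vanishes: by pigeonhole two of the |G| + 1
  -- elements 0·g, …, |G|·g coincide, say i·g = j·g with i < j, and then
  -- (j − i)·g = 0.
  vanishing-multiple : ∀ g → ∃ λ d → mul G (suc d) g ≡ 0#
  vanishing-multiple g
    with i , j , i<j , same ← pigeonhole (n<1+n size) (λ i → Inverse.to enum (mul G (toℕ i) g))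
    with d , i+d≡j ← m≤n⇒∃[o]m+o≡n i<j
    = d , identityˡ-unique (mul G (suc d) g) (mul G (toℕ i) g) (begin
      mul G (suc d) g ⊕ mul G (toℕ i) g  ≡⟨ mul-+ (suc d) (toℕ i) g ⟨
      mul G (suc d + toℕ i) g            ≡⟨ cong (λ k → mul G k g) (trans (cong suc (+-comm d (toℕ i))) i+d≡j) ⟩
      mul G (toℕ j) g                    ≡⟨ Injection.injective (↔⇒↣ enum) same ⟨
      mul G (toℕ i) g                    ∎)
    where open ≡-Reasoning

  order : ∀ g → Σ ℕ (IsOrder G g)
  order g with d , dg ← vanishing-multiple g
    with n , ng , least ← least-witness {λ m → mul G (suc m) g ≡ 0#} (λ m → mul G (suc m) g ≟ 0#) d dg
    = suc n , s≤s z≤n , ng , λ { (suc m) _ mg → s≤s (least m mg) }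

  -- The order of g divides every m with m·g = 0: the remainder m mod n also
  -- annihilates g and is smaller than n, so it must be 0.
  order-divides : ∀ {g n m} → IsOrder G g n → mul G m g ≡ 0# → n ∣ m
  order-divides {g} {n} {m} (0<n , ng , least) mg = m%n≡0⇒n∣m m n remainder-zero
    where
      instance
        n≢0 : NonZero n
        n≢0 = >-nonZero 0<n
      r : ℕ
      r = m % n
      rg : mul G r g ≡ 0#
      rg = begin
        mul G r g                               ≡⟨ identityʳ _ ⟨
        mul G r g ⊕ 0#                          ≡⟨ cong (mul G r g ⊕_) (mul-multiple (m / n) n g ng) ⟨
        mul G r g ⊕ mul G ((m / n) * n) g       ≡⟨ mul-+ r ((m / n) * n) g ⟨
        mul G (r + (m / n) * n) g               ≡⟨ cong (λ k → mul G k g) (m≡m%n+[m/n]*n m n) ⟨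
        mul G m g                               ≡⟨ mg ⟩
        0#                                      ∎
        where open ≡-Reasoning
      remainder-zero : r ≡ 0
      remainder-zero with r in eq
      ... | zero  = refl
      ... | suc _ = ⊥-elim (<⇒≱ (subst (_< n) eq (m%n<n m n)) (least _ (s≤s z≤n) (subst (λ k → mul G k g ≡ 0#) eq rg)))

  ⊑-trans : ∀ {T R S} → _⊑_ G T R → _⊑_ G R S → _⊑_ G T S
  ⊑-trans {T} (U , p) (V , q) =
    U ++ V , ↭-trans (↭-reflexive (sym (++-assoc T U V))) (↭-trans (++⁺ʳ V p) q)

  ↭⇒⊑ : ∀ {T S} → T ↭ S → _⊑_ G T S
  ↭⇒⊑ {T} p = [] , ↭-trans (↭-reflexive (++-identityʳ T)) p

  ⊑-length : ∀ {T S} → _⊑_ G T S → length T ≤ length S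
  ⊑-length {T} (U , p) = subst (length T ≤_) (trans (sym (length-++ T)) (↭-length p)) (m≤m+n _ _)

  ++-⊑ : ∀ {T V S Z} → (T ++ V) ↭ S → _⊑_ G Z V → _⊑_ G (T ++ Z) S
  ++-⊑ {T} {Z = Z} p (W , q) = W , ↭-trans (↭-reflexive (++-assoc T Z W)) (↭-trans (++⁺ˡ T q) p)

  filter-⊑ : ∀ {P : Carrier → Set} (P? : U.Decidable P) {T S} → _⊑_ G T S → _⊑_ G (filter P? T) (filter P? S)
  filter-⊑ P? {T} (U , p) = filter P? U , ↭-trans (↭-reflexive (sym (filter-++ P? T U))) (filter-↭ P? p)

  ⊑-replicate : ∀ {T N g} → _⊑_ G T (replicate N g) → T ≡ replicate (length T) g
  ⊑-replicate {T} {N} {g} (U , p) = all-g T (++⁻ˡ T (All-resp-↭ (↭-sym p) (replicate⁺ N refl)))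
    where
      all-g : ∀ T → All (_≡ g) T → T ≡ replicate (length T) g
      all-g []      []           = refl
      all-g (x ∷ T) (refl ∷ gT) = cong (x ∷_) (all-g T gT)

  -- Equality of sequences up to order is decidable; part (3) needs to know
  -- whether a member of Ω is (a rearrangement of) the removed sequence S.
  _≟↭_ : (S T : Seq G) → Dec (S ↭ T)
  [] ≟↭ []      = yes ↭-refl
  [] ≟↭ (_ ∷ _) = no λ p → 0≢1+n (↭-length p)
  (x ∷ S) ≟↭ T with any? (x ≟_) T
  ... | no x∉T = no λ p → x∉T (∈-resp-↭ p (here refl))
  ... | yes x∈T with T₁ , T₂ , refl ← ∈-∃++ x∈T with S ≟↭ (T₁ ++ T₂)
  ...   | yes q = yes (↭-trans (prep x q) (↭-sym (shift x T₁ T₂)))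
  ...   | no ¬q = no λ p → ¬q (drop-∷ (↭-trans p (shift x T₁ T₂)))

  replicate-⊑ : ∀ {a m} (g : Carrier) → a ≤ m → _⊑_ G (replicate a g) (replicate m g)
  replicate-⊑ {m = m} g z≤n = replicate m g , ↭-refl
  replicate-⊑ g (s≤s a≤m) with U , p ← replicate-⊑ g a≤m = U , prep g p

  separate : ∀ h L S → All (_∈ h ∷ L) S
    → Σ ℕ λ m → Σ (Seq G) λ R → (replicate m h ++ R) ↭ S × All (_∈ L) R
  separate h L []      []         = 0 , [] , ↭-refl , []
  separate h L (x ∷ S) (x∈ ∷ S∈) with m , R , p , R∈ ← separate h L S S∈ with x ≟ h | x∈
  ... | yes refl | _         = suc m , R , prep h p , R∈
  ... | no x≢h   | here x≡h  = ⊥-elim (x≢h x≡h)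
  ... | no _     | there x∈L = m , x ∷ R , ↭-trans (shift x (replicate m h) R) (prep x p) , x∈L ∷ R∈

  replicate-pigeonhole : ∀ (c : Carrier → ℕ) L S → All (_∈ L) S → sum (map c L) < length S
    → ∃ λ g → _⊑_ G (replicate (c g) g) S
  replicate-pigeonhole c []      []      []      ()
  replicate-pigeonhole c (h ∷ L) S       S∈      long
    with m , R , p , R∈ ← separate h L S S∈ | c h ≤? m
  ... | yes ch≤m = h , ⊑-trans (replicate-⊑ h ch≤m) (R , p)
  ... | no  ch≰m = map₂ (λ sub → ⊑-trans sub R⊑S) (replicate-pigeonhole c L R R∈ R-long)
    where
      |S|≡m+|R| : length S ≡ m + length R
      |S|≡m+|R| = trans (sym (↭-length p)) (trans (length-++ (replicate m h)) (cong (_+ length R) (length-replicate m)))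
      R⊑S : _⊑_ G R S
      R⊑S = replicate m h , ↭-trans (++-comm R (replicate m h)) p
      R-long : sum (map c L) < length R
      R-long = +-cancelˡ-< m _ _ (begin-strict
        m + sum (map c L)      <⟨ +-monoˡ-< (sum (map c L)) (≰⇒> ch≰m) ⟩
        c h + sum (map c L)    <⟨ long ⟩
        length S               ≡⟨ |S|≡m+|R| ⟩
        m + length R           ∎)
        where open ≤-Reasoning

  nonempty-length : ∀ (S : Seq G) → S ≢ [] → 0 < length S
  nonempty-length []      S≢[] = ⊥-elim (S≢[] refl)
  nonempty-length (_ ∷ _) _    = s≤s z≤n

  ∈⇒⊑ : ∀ {x S} → x ∈ S → _⊑_ G (x ∷ []) S
  ∈⇒⊑ {x} x∈S with S₁ , S₂ , refl ← ∈-∃++ x∈S = S₁ ++ S₂ , ↭-sym (shift x S₁ S₂)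

  ⊏⇒≁ : ∀ {T S} → _⊏_ G T S → ¬ (T ↭ S)
  ⊏⇒≁ {T} {S} (U , U≢[] , p) T↭S = <-irrefl (↭-length T↭S) (begin-strict
    length T               <⟨ m<m+n (length T) (nonempty-length U U≢[]) ⟩
    length T + length U    ≡⟨ length-++ T ⟨
    length (T ++ U)        ≡⟨ ↭-length p ⟩
    length S               ∎)
    where open ≤-Reasoning

  Works-≤ : ∀ {Ω : Seq G → Set} {s t} → s ≤ t → Works G Ω s → Works G Ω t
  Works-≤ s≤t w S long = w S (≤-trans s≤t long)

  Works-⊆ : ∀ {Ω Ω' : Seq G → Set} {t} → (∀ S → Ω S → Ω' S) → Works G Ω t → Works G Ω' t
  Works-⊆ Ω⊆Ω' w S long with T , T⊑S , ΩT ← w S long = T , T⊑S , Ω⊆Ω' T ΩT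

  same-thresholds : ∀ {Ω Ω' : Seq G → Set} → (∀ t → Works G Ω t ⇔ Works G Ω' t)
    → (DFinite G Ω ⇔ DFinite G Ω') × (∀ t → IsD G Ω t ⇔ IsD G Ω' t)
  same-thresholds {Ω} {Ω'} same =
      mk⇔ (map₂ (to _)) (map₂ (from _))
    , λ t → mk⇔ (λ (w , least) → to t w , λ t' w' → least t' (from t' w'))
                (λ (w , least) → from t w , λ t' w' → least t' (to t' w'))
    where
      to : ∀ t → Works G Ω t → Works G Ω' t
      to t = Equivalence.to (same t)
      from : ∀ t → Works G Ω' t → Works G Ω t
      from t = Equivalence.from (same t)

  PowersIn : (Seq G → Set) → Set
  PowersIn Ω = ∀ g n → IsOrder G g n → Σ ℕ λ k → 0 < k × Ω (replicate (k * n) g)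

  -- A member of Ω ⊂ B(G) lying inside a power of g is itself of the form
  -- g^{k·ord(g)} with k ≥ 1: it is a zero-sum power g^m, so ord(g) ∣ m, m ≠ 0.
  power-in-Ω : ∀ {Ω : Seq G → Set} {g n N T} → (∀ S → Ω S → InB G S) → IsOrder G g n
    → _⊑_ G T (replicate N g) → Ω T → Σ ℕ λ k → 0 < k × Ω (replicate (k * n) g)
  power-in-Ω {Ω} {g} {n} {T = T} Ω⊆B ord T⊑gᴺ ΩT = from-divisor (order-divides ord T-zero-sum)
    where
      T≡gᵐ : T ≡ replicate (length T) g
      T≡gᵐ = ⊑-replicate T⊑gᴺ
      T-zero-sum : mul G (length T) g ≡ 0#
      T-zero-sum = trans (sym (σ-replicate (length T) g))
                         (trans (cong (σ G) (sym T≡gᵐ)) (proj₂ (Ω⊆B T ΩT)))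
      as-power : ∀ {q} → length T ≡ q → T ≡ replicate q g
      as-power refl = T≡gᵐ
      from-divisor : n ∣ length T → Σ ℕ λ k → 0 < k × Ω (replicate (k * n) g)
      from-divisor (divides zero    |T|≡0)   = ⊥-elim (proj₁ (Ω⊆B T ΩT) (as-power |T|≡0))
      from-divisor (divides (suc k) |T|≡k*n) = suc k , s≤s z≤n , subst Ω (as-power |T|≡k*n) ΩT

  -- (1, ⇒) If t is a threshold, the sequence g^{t·ord(g)} must contain a
  -- member of Ω, which is a power of g of the required form.
  finite⇒powers : ∀ {Ω : Seq G → Set} → (∀ S → Ω S → InB G S) → DFinite G Ω → PowersIn Ω
  finite⇒powers Ω⊆B (t , w) g n ord@(0<n , _)
    with T , T⊑ , ΩT ← w (replicate (t * n) g)
                           (subst (t ≤_) (sym (length-replicate (t * n))) (m≤m*n t n {{>-nonZero 0<n}}))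
    = power-in-Ω Ω⊆B ord T⊑ ΩT

  -- (1, ⇐) With c(g) = k(g)·ord(g), every sequence longer than Σ_g c(g)
  -- contains some g^{c(g)} ∈ Ω by the multiplicity pigeonhole principle.
  powers⇒finite : ∀ {Ω : Seq G → Set} → PowersIn Ω → DFinite G Ω
  powers⇒finite {Ω} powers = suc (sum (map c elements)) , works
    where
      power : ∀ g → Σ ℕ λ k → 0 < k × Ω (replicate (k * proj₁ (order g)) g)
      power g = powers g (proj₁ (order g)) (proj₂ (order g))
      c : Carrier → ℕ
      c g = proj₁ (power g) * proj₁ (order g)
      works : Works G Ω (suc (sum (map c elements)))
      works S long with g , gᶜ⊑S ← replicate-pigeonhole c elements S (universal ∈-elements S) long
        = replicate (c g) g , gᶜ⊑S , proj₂ (proj₂ (power g))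

  -- (3) If S ∈ Ω has a proper subsequence S₁ ∈ Ω, any occurrence of S can be
  -- replaced by S₁, so Ω \ {S} admits every threshold of Ω.
  Works-remove : ∀ {Ω : Seq G → Set} {S S₁ t} → _⊏_ G S₁ S → Ω S₁
    → Works G Ω t → Works G (remove G Ω S) t
  Works-remove {S = S} {S₁} S₁⊏S@(U , _ , p) ΩS₁ w X long with T , T⊑X , ΩT ← w X long with T ≟↭ S
  ... | no  T≁S = T , T⊑X , ΩT , T≁S
  ... | yes T↭S = S₁ , ⊑-trans (U , p) (⊑-trans (↭⇒⊑ (↭-sym T↭S)) T⊑X) , ΩS₁ , ⊏⇒≁ S₁⊏S

  InB-++ : ∀ {T Z} → InB G T → InB G Z → InB G (T ++ Z)
  InB-++ {[]}    (T≢[] , _)   _             = ⊥-elim (T≢[] refl)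
  InB-++ {x ∷ T} {Z} (_ , σT) (_ , σZ) = (λ ()) , (begin
    σ G ((x ∷ T) ++ Z)          ≡⟨ σ-++ (x ∷ T) Z ⟩
    σ G (x ∷ T) ⊕ σ G Z         ≡⟨ cong₂ _⊕_ σT σZ ⟩
    0# ⊕ 0#                     ≡⟨ identityˡ 0# ⟩
    0#                          ∎)
    where open ≡-Reasoning

  InB-↭ : ∀ {S T} → S ↭ T → InB G S → InB G T
  InB-↭ S↭T (S≢[] , σS) =
    (λ T≡[] → S≢[] (↭-empty-inv (subst (_ ↭_) T≡[] S↭T))) , trans (sym (σ-↭ S↭T)) σS

  LongZeroSums : ℕ → Seq G → Set
  LongZeroSums m T = InB G T × m < length T

  LongZeroSums⊂B : ∀ m → SubsetB G (LongZeroSums m)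
  LongZeroSums⊂B m = (λ _ → proj₁) ,
    λ S T S↭T (S∈B , m<|S|) → InB-↭ S↭T S∈B , subst (m <_) (↭-length S↭T) m<|S|

  -- A zero-sum subsequence T of S whose complement has length ≥ D can be
  -- lengthened: the complement contains a further nonempty zero-sum sequence.
  extend-zero-sum : ∀ {D T V S} → Works G (InB G) D → (T ++ V) ↭ S → InB G T → D ≤ length V
    → Σ (Seq G) λ T' → _⊑_ G T' S × InB G T' × length T < length T'
  extend-zero-sum {T = T} wD p T∈B D≤|V| with Z , Z⊑V , Z∈B ← wD _ D≤|V|
    = T ++ Z , ++-⊑ p Z⊑V , InB-++ T∈B Z∈B ,
      subst (length T <_) (sym (length-++ T)) (m<m+n (length T) (nonempty-length Z (proj₁ Z∈B)))

  complement-long : ∀ {D k} {T V S : Seq G} → (T ++ V) ↭ S → D + k ≤ length S → length T ≤ k → D ≤ length V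
  complement-long {D} {k} {T} {V} {S} p long |T|≤k = +-cancelˡ-≤ (length T) D (length V) (begin
    length T + D          ≡⟨ +-comm (length T) D ⟩
    D + length T          ≤⟨ +-monoʳ-≤ D |T|≤k ⟩
    D + k                 ≤⟨ long ⟩
    length S              ≡⟨ ↭-length p ⟨
    length (T ++ V)       ≡⟨ length-++ T ⟩
    length T + length V   ∎)
    where open ≤-Reasoning

  long-zero-sum : ∀ {D} → Works G (InB G) D → ∀ j → Works G (LongZeroSums j) (D + j)
  long-zero-sum {D} wD zero S long with T , T⊑S , T∈B ← wD S (subst (_≤ length S) (+-identityʳ D) long)
    = T , T⊑S , T∈B , nonempty-length T (proj₁ T∈B)
  long-zero-sum {D} wD (suc j) S long
    with T , T⊑S@(V , p) , T∈B , j<|T| ← long-zero-sum wD j S (≤-trans (+-monoʳ-≤ D (n≤1+n j)) long)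
    with suc j <? length T
  ... | yes longer = T , T⊑S , T∈B , longer
  ... | no  ¬longer
    with T' , T'⊑S , T'∈B , |T|<|T'| ← extend-zero-sum wD p T∈B (complement-long {k = suc j} {T} p long (≮⇒≥ ¬longer))
    = T' , T'⊑S , T'∈B , <-≤-trans (s≤s j<|T|) |T|<|T'|

  zero? : U.Decidable (0# ≡_)
  zero? = 0# ≟_

  nonzero? : U.Decidable (λ x → ¬ (0# ≡ x))
  nonzero? x = ¬? (zero? x)

  σ-nonzero : ∀ T → σ G (filter nonzero? T) ≡ σ G T
  σ-nonzero []      = refl
  σ-nonzero (x ∷ T) with zero? x
  ... | yes 0≡x = begin
    σ G (filter nonzero? (x ∷ T))  ≡⟨ cong (σ G) (filter-reject nonzero? (λ 0≢x → 0≢x 0≡x)) ⟩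
    σ G (filter nonzero? T)        ≡⟨ σ-nonzero T ⟩
    σ G T                          ≡⟨ identityˡ (σ G T) ⟨
    0# ⊕ σ G T                     ≡⟨ cong (_⊕ σ G T) 0≡x ⟩
    x ⊕ σ G T                      ∎
    where open ≡-Reasoning
  ... | no  0≢x = trans (cong (σ G) (filter-accept nonzero? 0≢x)) (cong (x ⊕_) (σ-nonzero T))

  -- If S has no zero term and T ⊑ S · 0^m is a zero-sum sequence of length
  -- > m, then the nonzero part of T is a nonempty zero-sum subsequence of S:
  -- at most m terms of T are zero.
  nonzero-part : ∀ {m S T} → All (λ x → ¬ (0# ≡ x)) S → _⊑_ G T (S ++ replicate m 0#)
    → LongZeroSums m T → _⊑_ G (filter nonzero? T) S × InB G (filter nonzero? T)
  nonzero-part {m} {S} {T} S≢0 T⊑ ((_ , σT) , m<|T|) = nonzeros⊑S , nonempty , trans (σ-nonzero T) σT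
    where
      open ≡-Reasoning
      nonzeros⊑S : _⊑_ G (filter nonzero? T) S
      nonzeros⊑S = subst (_⊑_ G (filter nonzero? T)) (begin
        filter nonzero? (S ++ replicate m 0#)                      ≡⟨ filter-++ nonzero? S _ ⟩
        filter nonzero? S ++ filter nonzero? (replicate m 0#)      ≡⟨ cong₂ _++_ (filter-all nonzero? S≢0)
                                                                         (filter-none nonzero? (replicate⁺ m λ 0≢0 → 0≢0 refl)) ⟩
        S ++ []                                                    ≡⟨ ++-identityʳ S ⟩
        S                                                          ∎) (filter-⊑ nonzero? T⊑)
      zeros-of-padding : filter zero? (S ++ replicate m 0#) ≡ replicate m 0#
      zeros-of-padding = begin
        filter zero? (S ++ replicate m 0#)                         ≡⟨ filter-++ zero? S _ ⟩
        filter zero? S ++ filter zero? (replicate m 0#)            ≡⟨ cong₂ _++_ (filter-none zero? S≢0)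
                                                                         (filter-all zero? (replicate⁺ m refl)) ⟩
        replicate m 0#                                             ∎
      few-zeros : length (filter zero? T) ≤ m
      few-zeros = subst (length (filter zero? T) ≤_) (trans (cong length zeros-of-padding) (length-replicate m))
                        (⊑-length (filter-⊑ zero? T⊑))
      nonempty : filter nonzero? T ≢ []
      nonempty none = <⇒≱ m<|T| (subst (_≤ m) (sym (begin
        length T                                                   ≡⟨ length-filter-split zero? T ⟩
        length (filter zero? T) + length (filter nonzero? T)      ≡⟨ cong (λ R → length (filter zero? T) + length R) none ⟩
        length (filter zero? T) + 0                                ≡⟨ +-identityʳ _ ⟩
        length (filter zero? T)                                    ∎)) few-zeros)

  zero-padding : ∀ {D} m → Works G (LongZeroSums m) (D + m) → Works G (InB G) D
  zero-padding m w S long with any? zero? S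
  ... | yes 0∈S = 0# ∷ [] , ∈⇒⊑ 0∈S , (λ ()) , identityʳ 0#
  ... | no  0∉S with T , T⊑ , T-long ← w (S ++ replicate m 0#)
        (subst (_ ≤_) (sym (trans (length-++ S) (cong (length S +_) (length-replicate m)))) (+-monoˡ-≤ m long))
    = filter nonzero? T , nonzero-part (¬Any⇒All¬ S 0∉S) T⊑ T-long

  ¬Works-InB-0 : ¬ Works G (InB G) 0
  ¬Works-InB-0 w with T , T⊑[] , (T≢[] , _) ← w [] z≤n = <⇒≱ (nonempty-length T T≢[]) (⊑-length T⊑[])

  -- (4) For D = D(G), the family LongZeroSums m has invariant D + m: the
  -- threshold D + m works by long-zero-sum, and any threshold below it would
  -- give, by zero-padding, a threshold below D(G).  (D(G) = 0 is impossible.)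
  d-LongZeroSums : ∀ {D} → IsDavenport G D → ∀ m → IsD G (LongZeroSums m) (D + m)
  d-LongZeroSums {zero}  (wD , _)     m = ⊥-elim (¬Works-InB-0 wD)
  d-LongZeroSums {suc D} (wD , least) m = long-zero-sum wD m , λ t' w → ≮⇒≥ λ t'<1+D+m →
    1+n≰n (least D (zero-padding m (Works-≤ (≤-pred t'<1+D+m) w)))

proposition3p1 : (G : FinAbGroup)
    → ((Ω : Seq G → Set) → SubsetB G Ω
        → DFinite G Ω ⇔ (∀ g n → IsOrder G g n → Σ ℕ λ k → 0 < k × Ω (replicate (k * n) g)))
    × ((Ω Ω' : Seq G → Set) → SubsetB G Ω → SubsetB G Ω' → (∀ S → Ω S → Ω' S)
        → (DFinite G Ω → DFinite G Ω') × (∀ t t' → IsD G Ω t → IsD G Ω' t' → t' ≤ t))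
    × ((Ω : Seq G → Set) → SubsetB G Ω → (S S₁ : Seq G) → _⊏_ G S₁ S → Ω S → Ω S₁
        → (DFinite G (remove G Ω S) ⇔ DFinite G Ω) × (∀ t → IsD G (remove G Ω S) t ⇔ IsD G Ω t))
    × ((D t : ℕ) → IsDavenport G D → D ≤ t → Σ (Seq G → Set) λ Ω → SubsetB G Ω × IsD G Ω t)
proposition3p1 G =
    (λ Ω (Ω⊆B , _) → mk⇔ (finite⇒powers Ω⊆B) powers⇒finite)
  , (λ Ω Ω' _ _ Ω⊆Ω' → map₂ (Works-⊆ Ω⊆Ω') , λ t t' (w , _) (_ , least') → least' t (Works-⊆ Ω⊆Ω' w))
  , (λ Ω _ S S₁ S₁⊏S _ ΩS₁ → same-thresholds λ t → mk⇔ (Works-⊆ (λ _ → proj₁)) (Works-remove S₁⊏S ΩS₁))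
    -- (4) Ω = LongZeroSums (t − D) has invariant D + (t − D) = t
  , λ D t D-Davenport D≤t → LongZeroSums (t ∸ D) , LongZeroSums⊂B (t ∸ D) ,
      subst (IsD G (LongZeroSums (t ∸ D))) (m+[n∸m]≡n D≤t) (d-LongZeroSums D-Davenport (t ∸ D))
  where open Theory G
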